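{- For nonnegative integers $n,m$, let $P(n,m)$ be the number of partitions of $n$ with exactly $m$ missing integers (with $P(0,0)=1$), and let $\mathcal{M}_e(n)$ (resp. $\mathcal{M}_o(n)$) be the number of partitions of $n$ with an even (resp. odd) number of missing integers. Then, for $|q|<1$, \[ \sum_{n=0}^{\infty}\sum_{m=0}^{\infty} P(n,m)(-1)^mq^n=\sum_{n=0}^{\infty}\left(\mathcal{M}_e(n)-\mathcal{M}_o(n)\right)q^n=\frac{(-2q;q)_{\infty}}{(-q;q)_{\infty}}. \]
   Context: For a partition $\pi$ with largest part $L$, a missing integer of $\pi$ is a positive integer less than $L$ that does not occur as a part of $\pi$; the empty partition of $0$ has no missing integers. Notation: $(a;q)_\infty=\prod_{i\ge1}(1-aq^{i-1})$. -}

module Defs where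

open import Data.Bool using (Bool; true; false; _∧_; not; if_then_else_)
open import Data.Nat as ℕ using (ℕ; zero; suc; _≡ᵇ_; _≤ᵇ_; _%_)
open import Data.Integer as ℤ using (ℤ; +_; -1ℤ; 0ℤ; 1ℤ)
open import Data.List using (List; []; _∷_; map; concatMap; filter; length; foldr)
open import Data.Nat.ListAction using (sum)
open import Data.Bool.ListAction using (any)
open import Data.Bool using (T?)
open import Relation.Nullary.Decidable using (does)
open import Relation.Binary.PropositionalEquality using (_≡_)

range : ℕ → ℕ → List ℕ
range a zero = []
range a (suc k) = a ∷ range (suc a) k

listsOf : ℕ → List ℕ → List (List ℕ)
listsOf zero xs = [] ∷ []
listsOf (suc l) xs = concatMap (λ x → map (x ∷_) (listsOf l xs)) xs

nonincr : List ℕ → Bool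
nonincr [] = true
nonincr (x ∷ []) = true
nonincr (x ∷ y ∷ ys) = (y ≤ᵇ x) ∧ nonincr (y ∷ ys)

-- A partition of n is a nonincreasing list of positive integers with sum n.
-- Every such list has length ≤ n and parts in {1,...,n}; we enumerate all
-- candidate lists and keep exactly the partitions of n (each appears once).
partitions : ℕ → List (List ℕ)
partitions n =
  filter (λ p → T? (nonincr p))
    (filter (λ p → sum p ℕ.≟ n)
      (concatMap (λ l → listsOf l (range 1 n)) (range 0 (suc n))))

largest : List ℕ → ℕ
largest = foldr ℕ._⊔_ 0

occurs : ℕ → List ℕ → Bool
occurs i p = any (λ x → i ≡ᵇ x) p

-- number of missing integers: positive i < largest part not occurring as a part
missing : List ℕ → ℕ
missing p = length (filter (λ i → T? (not (occurs i p))) (range 1 (largest p ℕ.∸ 1)))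

P : ℕ → ℕ → ℕ
P n m = length (filter (λ p → missing p ℕ.≟ m) (partitions n))

isEven : ℕ → Bool
isEven m = m % 2 ≡ᵇ 0

Me : ℕ → ℕ
Me n = length (filter (λ p → T? (isEven (missing p))) (partitions n))

Mo : ℕ → ℕ
Mo n = length (filter (λ p → T? (not (isEven (missing p)))) (partitions n))

signedSum : ℕ → ℕ → ℤ
signedSum n N = foldr ℤ._+_ 0ℤ (map (λ m → (-1ℤ ℤ.^ m) ℤ.* (+ P n m)) (range 0 (suc N)))

Series : Set
Series = ℕ → ℤ

one : Series
one zero = 1ℤ
one (suc _) = 0ℤ

_⊛_ : Series → Series → Series
(f ⊛ g) n = foldr ℤ._+_ 0ℤ (map (λ k → f k ℤ.* g (n ℕ.∸ k)) (range 0 (suc n)))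

-- 1 + a q^i   (i ≥ 1)
onePlus : ℤ → ℕ → Series
onePlus a i n = if n ≡ᵇ 0 then 1ℤ else (if n ≡ᵇ i then a else 0ℤ)

-- 1/(1 + q^(suc j)) = Σ_k (-1)^k q^{k(suc j)}
invOnePlusQ : ℕ → Series
invOnePlusQ j n = if (n % suc j) ≡ᵇ 0 then -1ℤ ℤ.^ (n ℕ./ suc j) else 0ℤ

-- Π_{i=1}^{N} (1 + 2q^i)/(1 + q^i): truncation of (-2q;q)_∞/(-q;q)_∞
ratioProd : ℕ → Series
ratioProd zero = one
ratioProd (suc N) = (ratioProd N ⊛ onePlus (+ 2) (suc N)) ⊛ invOnePlusQ N

{-# OPTIONS --safe #-}
module Submission where

-- Let A(N, s) count the partitions of s into at most N parts, each with sign (-1)^(number of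
-- missing integers). Subtracting 1 from every part of a partition of s + l + 1 into exactly
-- l + 1 parts leaves a partition of s into at most l + 1 parts; the missing integers are shifted
-- up by one, and 1 becomes a new missing integer exactly when no part was 1, i.e. when all
-- l + 1 parts survive. Summing over l gives
--   A(N+1, s+N+1) + A(N+1, s) = A(N, s+N+1) + 2 A(N, s),
-- the coefficient form of (1 + q^(N+1)) R(N+1) = (1 + 2 q^(N+1)) R(N) for the truncated product
-- R(N) = ∏_{i ≤ N} (1 + 2q^i)/(1 + q^i). Since R(0) = 1 = A(0, -), the two agree for every N, and
-- for N ≥ n the coefficient A(N, n) is the signed count of all partitions of n, which is both
-- M_e(n) - M_o(n) and ∑_m (-1)^m P(n, m).

open import Defs
open import Data.Nat using (ℕ; _≤_)
open import Data.Integer using (ℤ; +_; _-_)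
open import Data.Product using (_×_)
open import Relation.Binary.PropositionalEquality using (_≡_)

open import Data.Bool using (Bool; true; false; not; _∧_; _∨_; if_then_else_)
open import Data.Empty using (⊥-elim)
open import Data.Integer using (0ℤ; 1ℤ; -1ℤ; _+_; _*_; -_; _^_)
import Data.Integer.Properties as ℤ
open import Data.Integer.Tactic.RingSolver using (solve-∀)
open import Data.List using (List; []; _∷_; map; _++_; length; filter; replicate; concatMap; foldr)
open import Data.List.Membership.Propositional using (_∈_; find)
open import Data.List.Membership.Propositional.Properties using (∈-map⁻; ∈-concatMap⁻; ∈-filter⁻)
open import Data.List.Properties using (length-filter)
open import Data.List.Relation.Unary.All as All using (All; []; _∷_)
open import Data.List.Relation.Unary.Any using (here; there)
open import Data.Nat as ℕ using (zero; suc; _<_; _≤′_; ≤′-refl; ≤′-step; z≤n; s≤s; _∸_; _⊔_; _≡ᵇ_; _≤ᵇ_)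
import Data.Nat.DivMod as ℕ
open import Data.Nat.Induction using (<-rec)
open import Data.Nat.ListAction using (sum)
import Data.Nat.Properties as ℕ
open import Data.Product using (_,_; proj₁; proj₂)
open import Function using (_∘_)
open import Relation.Binary.PropositionalEquality using (_≢_; refl; sym; trans; cong; cong₂; subst; module ≡-Reasoning)
open import Relation.Nullary using (yes; no; does)
open import Relation.Nullary.Decidable using (T?; dec-true; dec-false)
open import Relation.Unary using (Decidable)

private variable
  A B : Set

∑ : List A → (A → ℤ) → ℤ
∑ xs f = foldr _+_ 0ℤ (map f xs)

syntax ∑ xs (λ x → e) = ∑[ x ∈ xs ] e

keepIf : Bool → ℤ → ℤ
keepIf true  x = x
keepIf false x = 0ℤ

negateUnless : Bool → ℤ → ℤ
negateUnless true  x = x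
negateUnless false x = - x

∑-cong : (xs : List A) {f g : A → ℤ} → (∀ {x} → x ∈ xs → f x ≡ g x) → ∑ xs f ≡ ∑ xs g
∑-cong []       f≗g = refl
∑-cong (x ∷ xs) f≗g = cong₂ _+_ (f≗g (here refl)) (∑-cong xs (f≗g ∘ there))

∑-zero : (xs : List A) {f : A → ℤ} → (∀ {x} → x ∈ xs → f x ≡ 0ℤ) → ∑ xs f ≡ 0ℤ
∑-zero []       f≗0 = refl
∑-zero (x ∷ xs) f≗0 = cong₂ _+_ (f≗0 (here refl)) (∑-zero xs (f≗0 ∘ there))

∑-+ : (xs : List A) (f g : A → ℤ) → ∑[ x ∈ xs ] (f x + g x) ≡ ∑ xs f + ∑ xs g
∑-+ []       f g = refl
∑-+ (x ∷ xs) f g = trans (cong (_+_ (f x + g x)) (∑-+ xs f g)) (interchange (f x) (g x) (∑ xs f) (∑ xs g))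
  where
  interchange : ∀ a b c d → (a + b) + (c + d) ≡ (a + c) + (b + d)
  interchange = solve-∀

∑-neg : (xs : List A) (f : A → ℤ) → ∑[ x ∈ xs ] (- f x) ≡ - ∑ xs f
∑-neg []       f = refl
∑-neg (x ∷ xs) f = trans (cong (_+_ (- f x)) (∑-neg xs f)) (sym (ℤ.neg-distrib-+ (f x) (∑ xs f)))

∑-*ˡ : (c : ℤ) (xs : List A) (f : A → ℤ) → ∑[ x ∈ xs ] (c * f x) ≡ c * ∑ xs f
∑-*ˡ c []       f = sym (ℤ.*-zeroʳ c)
∑-*ˡ c (x ∷ xs) f = trans (cong (_+_ (c * f x)) (∑-*ˡ c xs f)) (sym (ℤ.*-distribˡ-+ c (f x) (∑ xs f)))

∑-++ : (xs ys : List A) (f : A → ℤ) → ∑ (xs ++ ys) f ≡ ∑ xs f + ∑ ys f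
∑-++ []       ys f = sym (ℤ.+-identityˡ (∑ ys f))
∑-++ (x ∷ xs) ys f = trans (cong (_+_ (f x)) (∑-++ xs ys f)) (sym (ℤ.+-assoc (f x) (∑ xs f) (∑ ys f)))

∑-map : (h : A → B) (xs : List A) (f : B → ℤ) → ∑ (map h xs) f ≡ ∑ xs (f ∘ h)
∑-map h []       f = refl
∑-map h (x ∷ xs) f = cong (_+_ (f (h x))) (∑-map h xs f)

∑-concatMap : (g : A → List B) (xs : List A) (f : B → ℤ) → ∑ (concatMap g xs) f ≡ ∑[ x ∈ xs ] ∑ (g x) f
∑-concatMap g []       f = refl
∑-concatMap g (x ∷ xs) f = trans (∑-++ (g x) (concatMap g xs) f) (cong (_+_ (∑ (g x) f)) (∑-concatMap g xs f))

∑-swap : (xs : List A) (ys : List B) (f : A → B → ℤ) → ∑[ x ∈ xs ] ∑ ys (f x) ≡ ∑[ y ∈ ys ] ∑[ x ∈ xs ] f x y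
∑-swap []       ys f = sym (∑-zero ys (λ _ → refl))
∑-swap (x ∷ xs) ys f =
  trans (cong (_+_ (∑ ys (f x))) (∑-swap xs ys f)) (sym (∑-+ ys (f x) (λ y → ∑[ x′ ∈ xs ] f x′ y)))

∑-filter : {P : A → Set} (P? : Decidable P) (xs : List A) (f : A → ℤ) →
           ∑ (filter P? xs) f ≡ ∑[ x ∈ xs ] keepIf (does (P? x)) (f x)
∑-filter P? []       f = refl
∑-filter P? (x ∷ xs) f with does (P? x)
... | true  = cong (_+_ (f x)) (∑-filter P? xs f)
... | false = trans (∑-filter P? xs f) (sym (ℤ.+-identityˡ _))

length-as-∑ : (xs : List A) → + length xs ≡ ∑[ x ∈ xs ] 1ℤ
length-as-∑ []       = refl
length-as-∑ (x ∷ xs) = cong (_+_ 1ℤ) (length-as-∑ xs)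

count-as-∑ : {P : A → Set} (P? : Decidable P) (xs : List A) →
             + length (filter P? xs) ≡ ∑[ x ∈ xs ] keepIf (does (P? x)) 1ℤ
count-as-∑ P? xs = trans (length-as-∑ (filter P? xs)) (∑-filter P? xs (λ _ → 1ℤ))

keepIf-∧ : ∀ a b v → keepIf (a ∧ b) v ≡ keepIf b (keepIf a v)
keepIf-∧ true  b     v = refl
keepIf-∧ false true  v = refl
keepIf-∧ false false v = refl

keepIf-comm : ∀ a b v → keepIf a (keepIf b v) ≡ keepIf b (keepIf a v)
keepIf-comm true  b     v = refl
keepIf-comm false true  v = refl
keepIf-comm false false v = refl

keepIf-keepIf-negateUnless : ∀ a c b v → keepIf a (keepIf c (negateUnless b v)) ≡ negateUnless b (keepIf c (keepIf a v))
keepIf-keepIf-negateUnless true  true  b     v = refl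
keepIf-keepIf-negateUnless true  false true  v = refl
keepIf-keepIf-negateUnless true  false false v = refl
keepIf-keepIf-negateUnless false true  true  v = refl
keepIf-keepIf-negateUnless false false true  v = refl
keepIf-keepIf-negateUnless false true  false v = refl
keepIf-keepIf-negateUnless false false false v = refl

∑-negateUnless : (b : Bool) (xs : List A) (f : A → ℤ) → ∑[ x ∈ xs ] negateUnless b (f x) ≡ negateUnless b (∑ xs f)
∑-negateUnless true  xs f = refl
∑-negateUnless false xs f = ∑-neg xs f

∈-range⁻ : ∀ {a k x} → x ∈ range a k → a ≤ x × x < a ℕ.+ k
∈-range⁻ {a} {suc k} (here refl) = ℕ.≤-refl , ℕ.m<m+n a ℕ.0<1+n
∈-range⁻ {a} {suc k} {x} (there x∈) with ∈-range⁻ x∈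
... | a<x , x<1+a+k = ℕ.<⇒≤ a<x , subst (x <_) (sym (ℕ.+-suc a k)) x<1+a+k

range-positive : ∀ {K x} → x ∈ range 1 K → 0 < x
range-positive x∈ = proj₁ (∈-range⁻ x∈)

range-suc : ∀ a k → range (suc a) k ≡ map suc (range a k)
range-suc a zero    = refl
range-suc a (suc k) = cong (suc a ∷_) (range-suc (suc a) k)

range-+ : ∀ a k j → range a (k ℕ.+ j) ≡ range a k ++ range (a ℕ.+ k) j
range-+ a zero    j = cong (λ b → range b j) (sym (ℕ.+-identityʳ a))
range-+ a (suc k) j = cong (a ∷_) (trans (range-+ (suc a) k j) (cong (λ b → range (suc a) k ++ range b j) (sym (ℕ.+-suc a k))))

range-snoc : ∀ k → range 0 (suc k) ≡ range 0 k ++ k ∷ []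
range-snoc k = trans (cong (range 0) (ℕ.+-comm 1 k)) (range-+ 0 k 1)

length-range : ∀ a k → length (range a k) ≡ k
length-range a zero    = refl
length-range a (suc k) = cong suc (length-range (suc a) k)

∑-range-suc : ∀ a k (f : ℕ → ℤ) → ∑ (range (suc a) k) f ≡ ∑[ i ∈ range a k ] f (suc i)
∑-range-suc a k f = trans (cong (λ r → ∑ r f) (range-suc a k)) (∑-map suc (range a k) f)

∑-range-single : ∀ a k {t} (f : ℕ → ℤ) → a ≤ t → t < a ℕ.+ k →
                 (∀ {m} → a ≤ m → m < a ℕ.+ k → m ≢ t → f m ≡ 0ℤ) → ∑ (range a k) f ≡ f t
∑-range-single a zero {t} f a≤t t<a+0 _ = ⊥-elim (ℕ.<-irrefl refl (ℕ.≤-<-trans a≤t (subst (t <_) (ℕ.+-identityʳ a) t<a+0)))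
∑-range-single a (suc k) {t} f a≤t t<a+1+k f≗0 with a ℕ.≟ t
... | yes refl = trans (cong (_+_ (f a)) (∑-zero (range (suc a) k) off-a)) (ℤ.+-identityʳ (f a))
  where
  off-a : ∀ {m} → m ∈ range (suc a) k → f m ≡ 0ℤ
  off-a {m} m∈ with ∈-range⁻ m∈
  ... | a<m , m<1+a+k = f≗0 (ℕ.<⇒≤ a<m) (subst (m <_) (sym (ℕ.+-suc a k)) m<1+a+k) (ℕ.>⇒≢ a<m)
... | no a≢t = trans (cong (_+ ∑ (range (suc a) k) f) (f≗0 ℕ.≤-refl (ℕ.m<m+n a ℕ.0<1+n) a≢t))
                     (trans (ℤ.+-identityˡ _) (∑-range-single (suc a) k f (ℕ.≤∧≢⇒< a≤t a≢t) t<1+a+k f≗0′))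
  where
  t<1+a+k = subst (t <_) (ℕ.+-suc a k) t<a+1+k
  f≗0′ : ∀ {m} → suc a ≤ m → m < suc a ℕ.+ k → m ≢ t → f m ≡ 0ℤ
  f≗0′ {m} a<m m<1+a+k = f≗0 (ℕ.<⇒≤ a<m) (subst (m <_) (sym (ℕ.+-suc a k)) m<1+a+k)

∑-listsOf-suc : ∀ l (xs : List ℕ) (F : List ℕ → ℤ) →
                ∑ (listsOf (suc l) xs) F ≡ ∑[ x ∈ xs ] ∑[ p ∈ listsOf l xs ] F (x ∷ p)
∑-listsOf-suc l xs F =
  trans (∑-concatMap _ xs F) (∑-cong xs (λ {x} _ → ∑-map (x ∷_) (listsOf l xs) F))

∑-listsOf-map : ∀ l (h : ℕ → ℕ) xs (F : List ℕ → ℤ) → ∑ (listsOf l (map h xs)) F ≡ ∑ (listsOf l xs) (F ∘ map h)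
∑-listsOf-map zero    h xs F = refl
∑-listsOf-map (suc l) h xs F = begin
  ∑ (listsOf (suc l) (map h xs)) F
    ≡⟨ ∑-listsOf-suc l (map h xs) F ⟩
  ∑[ x ∈ map h xs ] ∑[ p ∈ listsOf l (map h xs) ] F (x ∷ p)
    ≡⟨ ∑-map h xs _ ⟩
  ∑[ x ∈ xs ] ∑[ p ∈ listsOf l (map h xs) ] F (h x ∷ p)
    ≡⟨ ∑-cong xs (λ {x} _ → ∑-listsOf-map l h xs (F ∘ (h x ∷_))) ⟩
  ∑[ x ∈ xs ] ∑[ p ∈ listsOf l xs ] F (h x ∷ map h p)
    ≡⟨ ∑-listsOf-suc l xs (F ∘ map h) ⟨
  ∑ (listsOf (suc l) xs) (F ∘ map h)                                 ∎
  where open ≡-Reasoning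

∈-listsOf⁻ : ∀ {l xs p} → p ∈ listsOf l xs → length p ≡ l × All (_∈ xs) p
∈-listsOf⁻ {zero}  (here refl) = refl , []
∈-listsOf⁻ {suc l} {xs} p∈ with find (∈-concatMap⁻ (λ x → map (x ∷_) (listsOf l xs)) {xs} p∈)
... | x , x∈xs , p∈x∷ with ∈-map⁻ (x ∷_) p∈x∷
... | q , q∈ , refl with ∈-listsOf⁻ {l} q∈
... | refl , q⊆xs = refl , x∈xs ∷ q⊆xs

-- Coefficients of the truncated product

monomial : ℤ → ℕ → Series
monomial c t m = if m ≡ᵇ t then c else 0ℤ

monomial-off : ∀ c {t m} → m ≢ t → monomial c t m ≡ 0ℤ
monomial-off c {t} {m} m≢t = cong (λ b → if b then c else 0ℤ) (dec-false (m ℕ.≟ t) m≢t)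

monomial-on : ∀ c t → monomial c t t ≡ c
monomial-on c t = cong (λ b → if b then c else 0ℤ) (dec-true (t ℕ.≟ t) refl)

⊛-monomial : (X : Series) (c : ℤ) {t n : ℕ} → t ≤ n → (X ⊛ monomial c t) n ≡ X (n ∸ t) * c
⊛-monomial X c {t} {n} t≤n = begin
  (X ⊛ monomial c t) n
    ≡⟨ ∑-range-single 0 (suc n) _ z≤n (s≤s (ℕ.m∸n≤m n t)) off-diagonal ⟩
  X (n ∸ t) * monomial c t (n ∸ (n ∸ t))
    ≡⟨ cong (λ i → X (n ∸ t) * monomial c t i) (ℕ.m∸[m∸n]≡n t≤n) ⟩
  X (n ∸ t) * monomial c t t
    ≡⟨ cong (X (n ∸ t) *_) (monomial-on c t) ⟩
  X (n ∸ t) * c                             ∎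
  where
  open ≡-Reasoning
  off-diagonal : ∀ {k} → 0 ≤ k → k < suc n → k ≢ n ∸ t → X k * monomial c t (n ∸ k) ≡ 0ℤ
  off-diagonal {k} _ k<1+n k≢n∸t = trans (cong (X k *_) (monomial-off c {t} {n ∸ k} λ n∸k≡t →
    k≢n∸t (trans (sym (ℕ.m∸[m∸n]≡n (ℕ.≤-pred k<1+n))) (cong (n ∸_) n∸k≡t)))) (ℤ.*-zeroʳ (X k))

⊛-monomial-< : (X : Series) (c : ℤ) {t n : ℕ} → n < t → (X ⊛ monomial c t) n ≡ 0ℤ
⊛-monomial-< X c {t} {n} n<t = ∑-zero (range 0 (suc n)) λ {k} _ →
  trans (cong (X k *_) (monomial-off c {t} {n ∸ k} λ n∸k≡t → ℕ.<-irrefl n∸k≡t (ℕ.≤-<-trans (ℕ.m∸n≤m n k) n<t))) (ℤ.*-zeroʳ (X k))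

⊛-distribʳ-+ : (X f g : Series) (n : ℕ) → (X ⊛ (λ m → f m + g m)) n ≡ (X ⊛ f) n + (X ⊛ g) n
⊛-distribʳ-+ X f g n = trans (∑-cong (range 0 (suc n)) λ {k} _ → ℤ.*-distribˡ-+ (X k) (f (n ∸ k)) (g (n ∸ k)))
                             (∑-+ (range 0 (suc n)) (λ k → X k * f (n ∸ k)) (λ k → X k * g (n ∸ k)))

onePlus-as-monomials : ∀ a d m → onePlus a (suc d) m ≡ monomial 1ℤ 0 m + monomial a (suc d) m
onePlus-as-monomials a d zero    = refl
onePlus-as-monomials a d (suc m) = sym (ℤ.+-identityˡ _)

⊛-onePlus : (X : Series) (a : ℤ) (d n : ℕ) → (X ⊛ onePlus a (suc d)) n ≡ X n + (X ⊛ monomial a (suc d)) n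
⊛-onePlus X a d n = begin
  (X ⊛ onePlus a (suc d)) n
    ≡⟨ ∑-cong (range 0 (suc n)) (λ {k} _ → cong (X k *_) (onePlus-as-monomials a d (n ∸ k))) ⟩
  (X ⊛ (λ m → monomial 1ℤ 0 m + monomial a (suc d) m)) n
    ≡⟨ ⊛-distribʳ-+ X (monomial 1ℤ 0) (monomial a (suc d)) n ⟩
  (X ⊛ monomial 1ℤ 0) n + (X ⊛ monomial a (suc d)) n
    ≡⟨ cong (_+ (X ⊛ monomial a (suc d)) n) (⊛-monomial X 1ℤ z≤n) ⟩
  X n * 1ℤ + (X ⊛ monomial a (suc d)) n
    ≡⟨ cong (_+ (X ⊛ monomial a (suc d)) n) (ℤ.*-identityʳ (X n)) ⟩
  X n + (X ⊛ monomial a (suc d)) n                             ∎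
  where open ≡-Reasoning

⊛-onePlus-< : (X : Series) (a : ℤ) {d n : ℕ} → n < suc d → (X ⊛ onePlus a (suc d)) n ≡ X n
⊛-onePlus-< X a {d} {n} n<1+d =
  trans (⊛-onePlus X a d n) (trans (cong (_+_ (X n)) (⊛-monomial-< X a n<1+d)) (ℤ.+-identityʳ (X n)))

⊛-onePlus-+ : (X : Series) (a : ℤ) (d n : ℕ) → (X ⊛ onePlus a (suc d)) (n ℕ.+ suc d) ≡ X (n ℕ.+ suc d) + X n * a
⊛-onePlus-+ X a d n = trans (⊛-onePlus X a d (n ℕ.+ suc d)) (cong (_+_ (X (n ℕ.+ suc d))) (begin
  (X ⊛ monomial a (suc d)) (n ℕ.+ suc d)   ≡⟨ ⊛-monomial X a (ℕ.m≤n+m (suc d) n) ⟩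
  X (n ℕ.+ suc d ∸ suc d) * a              ≡⟨ cong (λ i → X i * a) (ℕ.m+n∸n≡m n (suc d)) ⟩
  X n * a                                  ∎))
  where open ≡-Reasoning

invOnePlusQ-< : ∀ j {m} → 0 < m → m < suc j → invOnePlusQ j m ≡ 0ℤ
invOnePlusQ-< j {suc m} _ m<1+j =
  cong (λ r → if r ≡ᵇ 0 then -1ℤ ^ (suc m ℕ./ suc j) else 0ℤ) (ℕ.m<n⇒m%n≡m m<1+j)

invOnePlusQ-+ : ∀ j m → invOnePlusQ j (m ℕ.+ suc j) ≡ - invOnePlusQ j m
invOnePlusQ-+ j m =
  trans (cong₂ (λ r q → if r ≡ᵇ 0 then -1ℤ ^ q else 0ℤ) %-shift /-shift) (negate-branch (m ℕ.% suc j ≡ᵇ 0))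
  where
  %-shift : (m ℕ.+ suc j) ℕ.% suc j ≡ m ℕ.% suc j
  %-shift = ℕ.[m+n]%n≡m%n m (suc j)
  /-shift : (m ℕ.+ suc j) ℕ./ suc j ≡ suc (m ℕ./ suc j)
  /-shift = trans (ℕ.m/n≡1+[m∸n]/n (ℕ.m≤n+m (suc j) m)) (cong (λ i → suc (i ℕ./ suc j)) (ℕ.m+n∸n≡m m (suc j)))
  negate-branch : ∀ b → (if b then -1ℤ ^ suc (m ℕ./ suc j) else 0ℤ) ≡ - (if b then -1ℤ ^ (m ℕ./ suc j) else 0ℤ)
  negate-branch true  = ℤ.-1*i≡-i _
  negate-branch false = refl

-- invOnePlusQ j vanishes on 1, …, j, so only the term m = a + k survives.
∑-invOnePlusQ-window : (Y : Series) (j a k : ℕ) → k ≤ j →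
                       ∑[ m ∈ range a (suc k) ] (Y m * invOnePlusQ j (a ℕ.+ k ∸ m)) ≡ Y (a ℕ.+ k)
∑-invOnePlusQ-window Y j a k k≤j = begin
  ∑[ m ∈ range a (suc k) ] (Y m * invOnePlusQ j (a ℕ.+ k ∸ m))
    ≡⟨ ∑-range-single a (suc k) _ (ℕ.m≤m+n a k) a+k<a+1+k off-diagonal ⟩
  Y (a ℕ.+ k) * invOnePlusQ j (a ℕ.+ k ∸ (a ℕ.+ k))
    ≡⟨ cong (λ i → Y (a ℕ.+ k) * invOnePlusQ j i) (ℕ.n∸n≡0 (a ℕ.+ k)) ⟩
  Y (a ℕ.+ k) * 1ℤ
    ≡⟨ ℤ.*-identityʳ (Y (a ℕ.+ k)) ⟩
  Y (a ℕ.+ k)                                                  ∎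
  where
  open ≡-Reasoning
  a+k<a+1+k : a ℕ.+ k < a ℕ.+ suc k
  a+k<a+1+k = ℕ.+-monoʳ-< a (ℕ.n<1+n k)
  off-diagonal : ∀ {m} → a ≤ m → m < a ℕ.+ suc k → m ≢ a ℕ.+ k → Y m * invOnePlusQ j (a ℕ.+ k ∸ m) ≡ 0ℤ
  off-diagonal {m} a≤m m<a+1+k m≢a+k = trans (cong (Y m *_) (invOnePlusQ-< j
      (ℕ.m<n⇒0<n∸m (ℕ.≤∧≢⇒< (ℕ.≤-pred (subst (m <_) (ℕ.+-suc a k) m<a+1+k)) m≢a+k))
      (s≤s (ℕ.≤-trans (ℕ.∸-monoʳ-≤ (a ℕ.+ k) a≤m) (ℕ.≤-trans (ℕ.≤-reflexive (ℕ.m+n∸m≡n a k)) k≤j)))))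
    (ℤ.*-zeroʳ (Y m))

⊛-invOnePlusQ-< : (Y : Series) (j : ℕ) {n : ℕ} → n < suc j → (Y ⊛ invOnePlusQ j) n ≡ Y n
⊛-invOnePlusQ-< Y j {n} n<1+j = ∑-invOnePlusQ-window Y j 0 n (ℕ.≤-pred n<1+j)

⊛-invOnePlusQ-+ : (Y : Series) (j n : ℕ) → (Y ⊛ invOnePlusQ j) (n ℕ.+ suc j) ≡ Y (n ℕ.+ suc j) - (Y ⊛ invOnePlusQ j) n
⊛-invOnePlusQ-+ Y j n = begin
  ∑ (range 0 (suc n ℕ.+ suc j)) F
    ≡⟨ cong (λ r → ∑ r F) (range-+ 0 (suc n) (suc j)) ⟩
  ∑ (range 0 (suc n) ++ range (suc n) (suc j)) F
    ≡⟨ ∑-++ (range 0 (suc n)) (range (suc n) (suc j)) F ⟩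
  ∑ (range 0 (suc n)) F + ∑ (range (suc n) (suc j)) F
    ≡⟨ cong₂ _+_ earlier window ⟩
  - (Y ⊛ invOnePlusQ j) n + Y (n ℕ.+ suc j)
    ≡⟨ ℤ.+-comm (- (Y ⊛ invOnePlusQ j) n) (Y (n ℕ.+ suc j)) ⟩
  Y (n ℕ.+ suc j) - (Y ⊛ invOnePlusQ j) n                         ∎
  where
  open ≡-Reasoning
  F : ℕ → ℤ
  F m = Y m * invOnePlusQ j (n ℕ.+ suc j ∸ m)
  earlier : ∑ (range 0 (suc n)) F ≡ - (Y ⊛ invOnePlusQ j) n
  earlier = trans (∑-cong (range 0 (suc n)) λ {m} m∈ → begin
      Y m * invOnePlusQ j (n ℕ.+ suc j ∸ m)
        ≡⟨ cong (λ i → Y m * invOnePlusQ j i) (ℕ.+-∸-comm (suc j) (ℕ.≤-pred (proj₂ (∈-range⁻ m∈)))) ⟩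
      Y m * invOnePlusQ j (n ∸ m ℕ.+ suc j)
        ≡⟨ cong (Y m *_) (invOnePlusQ-+ j (n ∸ m)) ⟩
      Y m * - invOnePlusQ j (n ∸ m)
        ≡⟨ ℤ.neg-distribʳ-* (Y m) _ ⟨
      - (Y m * invOnePlusQ j (n ∸ m))           ∎)
    (∑-neg (range 0 (suc n)) (λ m → Y m * invOnePlusQ j (n ∸ m)))
  window : ∑ (range (suc n) (suc j)) F ≡ Y (n ℕ.+ suc j)
  window = subst (λ t → ∑[ m ∈ range (suc n) (suc j) ] (Y m * invOnePlusQ j (t ∸ m)) ≡ Y t)
                 (sym (ℕ.+-suc n j)) (∑-invOnePlusQ-window Y j (suc n) j ℕ.≤-refl)

ratioProd-< : ∀ N {s} → s < suc N → ratioProd (suc N) s ≡ ratioProd N s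
ratioProd-< N s<1+N = trans (⊛-invOnePlusQ-< (ratioProd N ⊛ onePlus (+ 2) (suc N)) N s<1+N)
                            (⊛-onePlus-< (ratioProd N) (+ 2) s<1+N)

ratioProd-+ : ∀ N s → ratioProd (suc N) (s ℕ.+ suc N) ≡
                      ratioProd N (s ℕ.+ suc N) + ratioProd N s * + 2 - ratioProd (suc N) s
ratioProd-+ N s = trans (⊛-invOnePlusQ-+ (ratioProd N ⊛ onePlus (+ 2) (suc N)) N s)
                        (cong (_- ratioProd (suc N) s) (⊛-onePlus-+ (ratioProd N) (+ 2) N s))

≡ᵇ-+ʳ : ∀ a b c → (a ℕ.+ c ≡ᵇ b ℕ.+ c) ≡ (a ≡ᵇ b)
≡ᵇ-+ʳ a b c with a ℕ.≟ b
... | yes refl = trans (dec-true (a ℕ.+ c ℕ.≟ a ℕ.+ c) refl) (sym (dec-true (a ℕ.≟ a) refl))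
... | no a≢b   = trans (dec-false (a ℕ.+ c ℕ.≟ b ℕ.+ c) (a≢b ∘ ℕ.+-cancelʳ-≡ c a b)) (sym (dec-false (a ℕ.≟ b) a≢b))

head₀ : List ℕ → ℕ
head₀ []      = 0
head₀ (x ∷ _) = x

nonincr-∷ : ∀ x p → nonincr (x ∷ p) ≡ (head₀ p ≤ᵇ x) ∧ nonincr p
nonincr-∷ x []      = refl
nonincr-∷ x (y ∷ p) = refl

keepIf-nonincr-∷ : ∀ x y v → keepIf (nonincr (x ∷ y)) v ≡ keepIf (nonincr y) (keepIf (head₀ y ≤ᵇ x) v)
keepIf-nonincr-∷ x y v = trans (cong (λ b → keepIf b v) (nonincr-∷ x y)) (keepIf-∧ (head₀ y ≤ᵇ x) (nonincr y) v)

nonincr-map-suc : ∀ p → nonincr (map suc p) ≡ nonincr p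
nonincr-map-suc []          = refl
nonincr-map-suc (x ∷ [])    = refl
nonincr-map-suc (x ∷ y ∷ p) = cong₂ _∧_ (suc≤ᵇsuc y x) (nonincr-map-suc (y ∷ p))
  where
  suc≤ᵇsuc : ∀ m n → (suc m ≤ᵇ suc n) ≡ (m ≤ᵇ n)
  suc≤ᵇsuc zero    n = refl
  suc≤ᵇsuc (suc m) n = refl

sum-map-suc : ∀ p → sum (map suc p) ≡ sum p ℕ.+ length p
sum-map-suc []      = refl
sum-map-suc (x ∷ p) = begin
  suc (x ℕ.+ sum (map suc p))       ≡⟨ cong (λ t → suc (x ℕ.+ t)) (sum-map-suc p) ⟩
  suc (x ℕ.+ (sum p ℕ.+ length p))  ≡⟨ cong suc (ℕ.+-assoc x (sum p) (length p)) ⟨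
  suc (x ℕ.+ sum p ℕ.+ length p)    ≡⟨ ℕ.+-suc (x ℕ.+ sum p) (length p) ⟨
  x ℕ.+ sum p ℕ.+ suc (length p)    ∎
  where open ≡-Reasoning

sum-++-zeros : ∀ q m → sum (q ++ replicate m 0) ≡ sum q
sum-++-zeros []      zero    = refl
sum-++-zeros []      (suc m) = sum-++-zeros [] m
sum-++-zeros (x ∷ q) m       = cong (x ℕ.+_) (sum-++-zeros q m)

head₀-++-zeros : ∀ q m → head₀ (q ++ replicate m 0) ≡ head₀ q
head₀-++-zeros []      zero    = refl
head₀-++-zeros []      (suc m) = refl
head₀-++-zeros (x ∷ q) m       = refl

largest-++-zeros : ∀ q m → largest (q ++ replicate m 0) ≡ largest q
largest-++-zeros []      zero    = refl
largest-++-zeros []      (suc m) = largest-++-zeros [] m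
largest-++-zeros (x ∷ q) m       = cong (x ⊔_) (largest-++-zeros q m)

largest-map-suc : ∀ x p → largest (map suc (x ∷ p)) ≡ suc (largest (x ∷ p))
largest-map-suc x []      = cong suc (sym (ℕ.⊔-identityʳ x))
largest-map-suc x (y ∷ p) = cong (suc x ⊔_) (largest-map-suc y p)

largest≤sum : ∀ p → largest p ≤ sum p
largest≤sum []      = z≤n
largest≤sum (x ∷ p) = ℕ.⊔-lub (ℕ.m≤m+n x (sum p)) (ℕ.≤-trans (largest≤sum p) (ℕ.m≤n+m (sum p) x))

length≤sum : ∀ {p} → All (0 <_) p → length p ≤ sum p
length≤sum []          = z≤n
length≤sum (0<x ∷ 0<p) = ℕ.+-mono-≤ 0<x (length≤sum 0<p)

occurs-map-suc : ∀ i p → occurs (suc i) (map suc p) ≡ occurs i p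
occurs-map-suc i []      = refl
occurs-map-suc i (x ∷ p) = cong ((i ≡ᵇ x) ∨_) (occurs-map-suc i p)

occurs-suc-++-zeros : ∀ i q m → occurs (suc i) (q ++ replicate m 0) ≡ occurs (suc i) q
occurs-suc-++-zeros i []      zero    = refl
occurs-suc-++-zeros i []      (suc m) = occurs-suc-++-zeros i [] m
occurs-suc-++-zeros i (x ∷ q) m       = cong ((suc i ≡ᵇ x) ∨_) (occurs-suc-++-zeros i q m)

occurs-0-++-zeros : ∀ {q} m → All (0 <_) q → occurs 0 (q ++ replicate m 0) ≡ occurs 0 (replicate m 0)
occurs-0-++-zeros m []                = refl
occurs-0-++-zeros m (s≤s z≤n ∷ 0<q) = occurs-0-++-zeros m 0<q

missing-as-∑ : ∀ p → + missing p ≡ ∑[ i ∈ range 1 (largest p ∸ 1) ] keepIf (not (occurs i p)) 1ℤ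
missing-as-∑ p = count-as-∑ (λ i → T? (not (occurs i p))) (range 1 (largest p ∸ 1))

missing≤sum : ∀ p → missing p ≤ sum p
missing≤sum p = begin
  missing p
    ≤⟨ length-filter (λ i → T? (not (occurs i p))) (range 1 (largest p ∸ 1)) ⟩
  length (range 1 (largest p ∸ 1))
    ≡⟨ length-range 1 (largest p ∸ 1) ⟩
  largest p ∸ 1
    ≤⟨ ℕ.m∸n≤m (largest p) 1 ⟩
  largest p
    ≤⟨ largest≤sum p ⟩
  sum p                                            ∎
  where open ℕ.≤-Reasoning

missing-++-zeros : ∀ q m → missing (q ++ replicate m 0) ≡ missing q
missing-++-zeros q m = ℤ.+-injective (begin
  + missing (q ++ zeros)
    ≡⟨ missing-as-∑ (q ++ zeros) ⟩
  ∑[ i ∈ range 1 (largest (q ++ zeros) ∸ 1) ] keepIf (not (occurs i (q ++ zeros))) 1ℤ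
    ≡⟨ cong (λ L → ∑[ i ∈ range 1 (L ∸ 1) ] keepIf (not (occurs i (q ++ zeros))) 1ℤ) (largest-++-zeros q m) ⟩
  ∑[ i ∈ range 1 (largest q ∸ 1) ] keepIf (not (occurs i (q ++ zeros))) 1ℤ
    ≡⟨ ∑-range-suc 0 (largest q ∸ 1) _ ⟩
  ∑[ i ∈ range 0 (largest q ∸ 1) ] keepIf (not (occurs (suc i) (q ++ zeros))) 1ℤ
    ≡⟨ ∑-cong (range 0 (largest q ∸ 1)) (λ {i} _ → cong (λ b → keepIf (not b) 1ℤ) (occurs-suc-++-zeros i q m)) ⟩
  ∑[ i ∈ range 0 (largest q ∸ 1) ] keepIf (not (occurs (suc i) q)) 1ℤ
    ≡⟨ ∑-range-suc 0 (largest q ∸ 1) _ ⟨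
  ∑[ i ∈ range 1 (largest q ∸ 1) ] keepIf (not (occurs i q)) 1ℤ
    ≡⟨ missing-as-∑ q ⟨
  + missing q                                                                     ∎)
  where
  open ≡-Reasoning
  zeros = replicate m 0

missing-map-suc : ∀ x p → + missing (map suc (x ∷ p)) ≡ keepIf (not (occurs 0 (x ∷ p))) 1ℤ + + missing (x ∷ p)
missing-map-suc x p = begin
  + missing (map suc y)
    ≡⟨ missing-as-∑ (map suc y) ⟩
  ∑[ i ∈ range 1 (largest (map suc y) ∸ 1) ] keepIf (not (occurs i (map suc y))) 1ℤ
    ≡⟨ cong (λ L → ∑[ i ∈ range 1 (L ∸ 1) ] keepIf (not (occurs i (map suc y))) 1ℤ) (largest-map-suc x p) ⟩
  ∑[ i ∈ range 1 (largest y) ] keepIf (not (occurs i (map suc y))) 1ℤ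
    ≡⟨ ∑-range-suc 0 (largest y) _ ⟩
  ∑[ i ∈ range 0 (largest y) ] keepIf (not (occurs (suc i) (map suc y))) 1ℤ
    ≡⟨ ∑-cong (range 0 (largest y)) (λ {i} _ → cong (λ b → keepIf (not b) 1ℤ) (occurs-map-suc i y)) ⟩
  ∑[ i ∈ range 0 (largest y) ] keepIf (not (occurs i y)) 1ℤ
    ≡⟨ split-off-0 (largest y) (λ L≡0 → x≡0⇒0∈y (ℕ.n≤0⇒n≡0 (subst (x ≤_) L≡0 (ℕ.m≤m⊔n x (largest p))))) ⟩
  keepIf (not (occurs 0 y)) 1ℤ + ∑[ i ∈ range 1 (largest y ∸ 1) ] keepIf (not (occurs i y)) 1ℤ
    ≡⟨ cong (_+_ (keepIf (not (occurs 0 y)) 1ℤ)) (missing-as-∑ y) ⟨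
  keepIf (not (occurs 0 y)) 1ℤ + + missing y                                     ∎
  where
  open ≡-Reasoning
  y = x ∷ p
  x≡0⇒0∈y : x ≡ 0 → occurs 0 y ≡ true
  x≡0⇒0∈y refl = refl
  split-off-0 : ∀ L → (L ≡ 0 → occurs 0 y ≡ true) → ∑[ i ∈ range 0 L ] keepIf (not (occurs i y)) 1ℤ ≡
                keepIf (not (occurs 0 y)) 1ℤ + ∑[ i ∈ range 1 (L ∸ 1) ] keepIf (not (occurs i y)) 1ℤ
  split-off-0 zero    0∈y rewrite 0∈y refl = refl
  split-off-0 (suc L) _   = refl

missingSign : List ℕ → ℤ
missingSign p = -1ℤ ^ missing p

missingSign-map-suc : ∀ x p → missingSign (map suc (x ∷ p)) ≡ negateUnless (occurs 0 (x ∷ p)) (missingSign (x ∷ p))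
missingSign-map-suc x p = sign-of-step (occurs 0 (x ∷ p)) (missing-map-suc x p)
  where
  sign-of-step : ∀ b {m m′} → + m′ ≡ keepIf (not b) 1ℤ + + m → -1ℤ ^ m′ ≡ negateUnless b (-1ℤ ^ m)
  sign-of-step true  e rewrite ℤ.+-injective e = refl
  sign-of-step false e rewrite ℤ.+-injective e = ℤ.-1*i≡-i _

-1^-parity : ∀ m → -1ℤ ^ m ≡ keepIf (isEven m) 1ℤ - keepIf (not (isEven m)) 1ℤ
-1^-parity zero          = refl
-1^-parity (suc zero)    = refl
-1^-parity (suc (suc m)) = trans (double-negation (-1ℤ ^ m)) (-1^-parity m)
  where
  double-negation : ∀ x → -1ℤ * (-1ℤ * x) ≡ x
  double-negation = solve-∀

-- Signed counts of partitions with a bounded number of parts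

partitionSign : ℕ → List ℕ → ℤ
partitionSign s p = keepIf (sum p ≡ᵇ s) (keepIf (nonincr p) (missingSign p))

signedPartitions : ℕ → ℕ → ℕ → ℤ
signedPartitions K l s = ∑[ p ∈ listsOf l (range 1 K) ] partitionSign s p

signedPartitions≤ : ℕ → ℕ → ℕ → ℤ
signedPartitions≤ K N s = ∑[ l ∈ range 0 (suc N) ] signedPartitions K l s

partitionCandidates : ℕ → List (List ℕ)
partitionCandidates n = concatMap (λ l → listsOf l (range 1 n)) (range 0 (suc n))

∑partitions≡signedPartitions≤ : ∀ n → ∑ (partitions n) missingSign ≡ signedPartitions≤ n n n
∑partitions≡signedPartitions≤ n = begin
  ∑ (partitions n) missingSign
    ≡⟨ ∑-filter (λ p → T? (nonincr p)) (filter (λ p → sum p ℕ.≟ n) (partitionCandidates n)) missingSign ⟩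
  ∑[ p ∈ filter (λ p → sum p ℕ.≟ n) (partitionCandidates n) ] keepIf (nonincr p) (missingSign p)
    ≡⟨ ∑-filter (λ p → sum p ℕ.≟ n) (partitionCandidates n) _ ⟩
  ∑ (partitionCandidates n) (partitionSign n)
    ≡⟨ ∑-concatMap (λ l → listsOf l (range 1 n)) (range 0 (suc n)) (partitionSign n) ⟩
  signedPartitions≤ n n n   ∎
  where open ≡-Reasoning

∈-partitions⁻ : ∀ {n p} → p ∈ partitions n → sum p ≡ n
∈-partitions⁻ {n} p∈ =
  proj₂ (∈-filter⁻ (λ p → sum p ℕ.≟ n) {xs = partitionCandidates n} (proj₁ (∈-filter⁻ (λ p → T? (nonincr p)) p∈)))

signedPartitions-< : ∀ K {l s} → s < l → signedPartitions K l s ≡ 0ℤ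
signedPartitions-< K {l} {s} s<l = ∑-zero (listsOf l (range 1 K)) λ {p} p∈ →
  let length≡l , p⊆ = ∈-listsOf⁻ p∈
      s<sum = ℕ.<-≤-trans s<l (subst (_≤ sum p) length≡l (length≤sum (All.map range-positive p⊆)))
  in cong (λ b → keepIf b (keepIf (nonincr p) (missingSign p))) (dec-false (sum p ℕ.≟ s) (ℕ.>⇒≢ s<sum))

∑-nonincr-0∷ : ∀ N {xs} → (∀ {x} → x ∈ xs → 0 < x) → (H : List ℕ → ℤ) →
               ∑[ y ∈ listsOf N (0 ∷ xs) ] keepIf (nonincr (0 ∷ y)) (H y) ≡ H (replicate N 0)
∑-nonincr-0∷ zero    _    H = ℤ.+-identityʳ (H [])
∑-nonincr-0∷ (suc N) {xs} xs>0 H = begin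
  ∑[ y ∈ listsOf (suc N) (0 ∷ xs) ] keepIf (nonincr (0 ∷ y)) (H y)
    ≡⟨ ∑-listsOf-suc N (0 ∷ xs) _ ⟩
  ∑[ y ∈ listsOf N (0 ∷ xs) ] keepIf (nonincr (0 ∷ y)) (H (0 ∷ y))
    + ∑[ x ∈ xs ] ∑[ y ∈ listsOf N (0 ∷ xs) ] keepIf (nonincr (0 ∷ x ∷ y)) (H (x ∷ y))
    ≡⟨ cong₂ _+_ (∑-nonincr-0∷ N xs>0 (H ∘ (0 ∷_))) (∑-zero xs x∷-excluded) ⟩
  H (replicate (suc N) 0) + 0ℤ
    ≡⟨ ℤ.+-identityʳ _ ⟩
  H (replicate (suc N) 0)                                                       ∎
  where
  open ≡-Reasoning
  x∷-excluded : ∀ {x} → x ∈ xs → ∑[ y ∈ listsOf N (0 ∷ xs) ] keepIf (nonincr (0 ∷ x ∷ y)) (H (x ∷ y)) ≡ 0ℤ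
  x∷-excluded x∈ with xs>0 x∈
  ... | s≤s z≤n = ∑-zero (listsOf N (0 ∷ xs)) (λ _ → refl)

∑-nonincr-split-zeros : ∀ N {xs} → (∀ {x} → x ∈ xs → 0 < x) → (G : List ℕ → ℤ) →
  ∑[ y ∈ listsOf N (0 ∷ xs) ] keepIf (nonincr y) (G y) ≡
  ∑[ j ∈ range 0 (suc N) ] ∑[ q ∈ listsOf j xs ] keepIf (nonincr q) (G (q ++ replicate (N ∸ j) 0))
∑-nonincr-split-zeros zero    _    G = sym (ℤ.+-identityʳ (G [] + 0ℤ))
∑-nonincr-split-zeros (suc N) {xs} xs>0 G = begin
  ∑[ y ∈ listsOf (suc N) (0 ∷ xs) ] keepIf (nonincr y) (G y)
    ≡⟨ ∑-listsOf-suc N (0 ∷ xs) _ ⟩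
  ∑[ y ∈ listsOf N (0 ∷ xs) ] keepIf (nonincr (0 ∷ y)) (G (0 ∷ y))
    + ∑[ x ∈ xs ] ∑[ y ∈ listsOf N (0 ∷ xs) ] keepIf (nonincr (x ∷ y)) (G (x ∷ y))
    ≡⟨ cong₂ _+_ (∑-nonincr-0∷ N xs>0 (G ∘ (0 ∷_)))
                 (∑-cong xs (λ {x} _ → ∑-cong (listsOf N (0 ∷ xs)) (λ {y} _ → keepIf-nonincr-∷ x y (G (x ∷ y))))) ⟩
  G (replicate (suc N) 0) + ∑[ x ∈ xs ] ∑[ y ∈ listsOf N (0 ∷ xs) ] keepIf (nonincr y) (G′ x y)
    ≡⟨ cong (_+_ (G (replicate (suc N) 0))) (∑-cong xs (λ {x} _ → ∑-nonincr-split-zeros N xs>0 (G′ x))) ⟩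
  G (replicate (suc N) 0) + ∑[ x ∈ xs ] ∑[ j ∈ range 0 (suc N) ] T′ x j
    ≡⟨ cong (_+_ (G (replicate (suc N) 0))) (∑-swap xs (range 0 (suc N)) _) ⟩
  G (replicate (suc N) 0) + ∑[ j ∈ range 0 (suc N) ] ∑[ x ∈ xs ] T′ x j
    ≡⟨ cong₂ _+_ (sym (ℤ.+-identityʳ (G (replicate (suc N) 0))))
                 (∑-cong (range 0 (suc N)) (λ {j} _ → prepend-part j)) ⟩
  T 0 + ∑[ j ∈ range 0 (suc N) ] T (suc j)
    ≡⟨ cong (_+_ (T 0)) (∑-range-suc 0 (suc N) T) ⟨
  ∑[ j ∈ range 0 (suc (suc N)) ] T j                                              ∎
  where
  open ≡-Reasoning
  G′ : ℕ → List ℕ → ℤ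
  G′ x y = keepIf (head₀ y ≤ᵇ x) (G (x ∷ y))
  T : ℕ → ℤ
  T j = ∑[ q ∈ listsOf j xs ] keepIf (nonincr q) (G (q ++ replicate (suc N ∸ j) 0))
  T′ : ℕ → ℕ → ℤ
  T′ x j = ∑[ q ∈ listsOf j xs ] keepIf (nonincr q) (G′ x (q ++ replicate (N ∸ j) 0))
  prepend-part : ∀ j → ∑[ x ∈ xs ] T′ x j ≡ T (suc j)
  prepend-part j = trans (∑-cong xs λ {x} _ → ∑-cong (listsOf j xs) λ {q} _ →
                           trans (cong (λ h → keepIf (nonincr q) (keepIf (h ≤ᵇ x) (G (x ∷ q ++ replicate (N ∸ j) 0))))
                                       (head₀-++-zeros q (N ∸ j)))
                                 (sym (keepIf-nonincr-∷ x q (G (x ∷ q ++ replicate (N ∸ j) 0)))))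
                         (sym (∑-listsOf-suc j xs (λ q → keepIf (nonincr q) (G (q ++ replicate (N ∸ j) 0)))))

liftedSign : ℕ → List ℕ → ℤ
liftedSign s y = keepIf (sum y ≡ᵇ s) (negateUnless (occurs 0 y) (missingSign y))

partitionSign-map-suc : ∀ s {l} y → length y ≡ suc l → partitionSign (s ℕ.+ suc l) (map suc y) ≡ keepIf (nonincr y) (liftedSign s y)
partitionSign-map-suc s y@(x ∷ p) refl = begin
  keepIf (sum (map suc y) ≡ᵇ s ℕ.+ length y) (keepIf (nonincr (map suc y)) (missingSign (map suc y)))
    ≡⟨ cong₂ keepIf sum-condition (cong₂ keepIf (nonincr-map-suc y) (missingSign-map-suc x p)) ⟩
  keepIf (sum y ≡ᵇ s) (keepIf (nonincr y) (negateUnless (occurs 0 y) (missingSign y)))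
    ≡⟨ keepIf-comm (sum y ≡ᵇ s) (nonincr y) _ ⟩
  keepIf (nonincr y) (liftedSign s y)   ∎
  where
  open ≡-Reasoning
  sum-condition : (sum (map suc y) ≡ᵇ s ℕ.+ length y) ≡ (sum y ≡ᵇ s)
  sum-condition = trans (cong (_≡ᵇ s ℕ.+ length y) (sum-map-suc y)) (≡ᵇ-+ʳ (sum y) s (length y))

liftedSign-++-zeros : ∀ s m {q} → All (0 <_) q →
  keepIf (nonincr q) (liftedSign s (q ++ replicate m 0)) ≡ negateUnless (occurs 0 (replicate m 0)) (partitionSign s q)
liftedSign-++-zeros s m {q} q>0 = begin
  keepIf (nonincr q) (keepIf (sum (q ++ zeros) ≡ᵇ s) (negateUnless (occurs 0 (q ++ zeros)) (missingSign (q ++ zeros))))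
    ≡⟨ cong₂ (λ t b → keepIf (nonincr q) (keepIf (t ≡ᵇ s) (negateUnless b (missingSign (q ++ zeros)))))
             (sum-++-zeros q m) (occurs-0-++-zeros m q>0) ⟩
  keepIf (nonincr q) (keepIf (sum q ≡ᵇ s) (negateUnless (occurs 0 zeros) (-1ℤ ^ missing (q ++ zeros))))
    ≡⟨ cong (λ k → keepIf (nonincr q) (keepIf (sum q ≡ᵇ s) (negateUnless (occurs 0 zeros) (-1ℤ ^ k)))) (missing-++-zeros q m) ⟩
  keepIf (nonincr q) (keepIf (sum q ≡ᵇ s) (negateUnless (occurs 0 zeros) (missingSign q)))
    ≡⟨ keepIf-keepIf-negateUnless (nonincr q) (sum q ≡ᵇ s) (occurs 0 zeros) (missingSign q) ⟩
  negateUnless (occurs 0 zeros) (partitionSign s q)   ∎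
  where
  open ≡-Reasoning
  zeros = replicate m 0

signedPartitions-suc : ∀ K l s →
  signedPartitions (suc K) (suc l) (s ℕ.+ suc l) ≡ signedPartitions≤ K l s - signedPartitions K (suc l) s
signedPartitions-suc K l s = begin
  ∑[ p ∈ listsOf (suc l) (range 1 (suc K)) ] partitionSign (s ℕ.+ suc l) p
    ≡⟨ cong (λ r → ∑ (listsOf (suc l) r) (partitionSign (s ℕ.+ suc l))) (range-suc 0 (suc K)) ⟩
  ∑[ p ∈ listsOf (suc l) (map suc (range 0 (suc K))) ] partitionSign (s ℕ.+ suc l) p
    ≡⟨ ∑-listsOf-map (suc l) suc (range 0 (suc K)) (partitionSign (s ℕ.+ suc l)) ⟩
  ∑[ y ∈ listsOf (suc l) (0 ∷ range 1 K) ] partitionSign (s ℕ.+ suc l) (map suc y)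
    ≡⟨ ∑-cong (listsOf (suc l) (0 ∷ range 1 K)) (λ {y} y∈ → partitionSign-map-suc s y (proj₁ (∈-listsOf⁻ y∈))) ⟩
  ∑[ y ∈ listsOf (suc l) (0 ∷ range 1 K) ] keepIf (nonincr y) (liftedSign s y)
    ≡⟨ ∑-nonincr-split-zeros (suc l) range-positive (liftedSign s) ⟩
  ∑[ j ∈ range 0 (suc (suc l)) ] ∑[ q ∈ listsOf j (range 1 K) ] keepIf (nonincr q) (liftedSign s (q ++ replicate (suc l ∸ j) 0))
    ≡⟨ ∑-cong (range 0 (suc (suc l))) (λ {j} _ → strip-zeros j) ⟩
  ∑ (range 0 (suc (suc l))) F
    ≡⟨ cong (λ r → ∑ r F) (range-snoc (suc l)) ⟩
  ∑ (range 0 (suc l) ++ suc l ∷ []) F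
    ≡⟨ ∑-++ (range 0 (suc l)) (suc l ∷ []) F ⟩
  ∑ (range 0 (suc l)) F + (F (suc l) + 0ℤ)
    ≡⟨ cong₂ _+_ (∑-cong (range 0 (suc l)) (λ j∈ → fewer-parts (ℕ.≤-pred (proj₂ (∈-range⁻ j∈))))) (ℤ.+-identityʳ (F (suc l))) ⟩
  signedPartitions≤ K l s + F (suc l)
    ≡⟨ cong (λ m → signedPartitions≤ K l s + negateUnless (occurs 0 (replicate m 0)) (signedPartitions K (suc l) s))
            (ℕ.n∸n≡0 l) ⟩
  signedPartitions≤ K l s - signedPartitions K (suc l) s   ∎
  where
  open ≡-Reasoning
  F : ℕ → ℤ
  F j = negateUnless (occurs 0 (replicate (suc l ∸ j) 0)) (signedPartitions K j s)
  strip-zeros : ∀ j → ∑[ q ∈ listsOf j (range 1 K) ] keepIf (nonincr q) (liftedSign s (q ++ replicate (suc l ∸ j) 0)) ≡ F j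
  strip-zeros j = trans
    (∑-cong (listsOf j (range 1 K)) λ q∈ →
       liftedSign-++-zeros s (suc l ∸ j) (All.map (range-positive {K}) (proj₂ (∈-listsOf⁻ {j} q∈))))
    (∑-negateUnless (occurs 0 (replicate (suc l ∸ j) 0)) (listsOf j (range 1 K)) (partitionSign s))
  fewer-parts : ∀ {j} → j ≤ l → F j ≡ signedPartitions K j s
  fewer-parts {j} j≤l = cong (λ m → negateUnless (occurs 0 (replicate m 0)) (signedPartitions K j s)) (ℕ.+-∸-assoc 1 j≤l)

signedPartitions≤-suc : ∀ K N s → signedPartitions≤ K (suc N) s ≡ signedPartitions≤ K N s + signedPartitions K (suc N) s
signedPartitions≤-suc K N s = begin
  ∑ (range 0 (suc (suc N))) E                ≡⟨ cong (λ r → ∑ r E) (range-snoc (suc N)) ⟩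
  ∑ (range 0 (suc N) ++ suc N ∷ []) E        ≡⟨ ∑-++ (range 0 (suc N)) (suc N ∷ []) E ⟩
  signedPartitions≤ K N s + (E (suc N) + 0ℤ) ≡⟨ cong (_+_ (signedPartitions≤ K N s)) (ℤ.+-identityʳ (E (suc N))) ⟩
  signedPartitions≤ K N s + E (suc N)        ∎
  where
  open ≡-Reasoning
  E : ℕ → ℤ
  E l = signedPartitions K l s

signedPartitions≤-< : ∀ K N {s} → s < suc N → signedPartitions≤ K (suc N) s ≡ signedPartitions≤ K N s
signedPartitions≤-< K N {s} s<1+N = trans (signedPartitions≤-suc K N s)
  (trans (cong (_+_ (signedPartitions≤ K N s)) (signedPartitions-< K s<1+N)) (ℤ.+-identityʳ _))

signedPartitions≤-+ : ∀ K N s → signedPartitions≤ (suc K) (suc N) (s ℕ.+ suc N) ≡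
  signedPartitions≤ (suc K) N (s ℕ.+ suc N) + signedPartitions≤ K N s * + 2 - signedPartitions≤ K (suc N) s
signedPartitions≤-+ K N s = begin
  signedPartitions≤ (suc K) (suc N) (s ℕ.+ suc N)
    ≡⟨ signedPartitions≤-suc (suc K) N (s ℕ.+ suc N) ⟩
  S′ + signedPartitions (suc K) (suc N) (s ℕ.+ suc N)
    ≡⟨ cong (_+_ S′) (signedPartitions-suc K N s) ⟩
  S′ + (S - E)
    ≡⟨ rearrange S′ S E ⟩
  S′ + S * + 2 - (S + E)
    ≡⟨ cong (λ t → S′ + S * + 2 - t) (signedPartitions≤-suc K N s) ⟨
  S′ + S * + 2 - signedPartitions≤ K (suc N) s                      ∎
  where
  open ≡-Reasoning
  S′ = signedPartitions≤ (suc K) N (s ℕ.+ suc N)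
  S = signedPartitions≤ K N s
  E = signedPartitions K (suc N) s
  rearrange : ∀ a b e → a + (b - e) ≡ a + b * + 2 - (b + e)
  rearrange = solve-∀

signedPartitions≤-stable : ∀ K {s N} → s ≤ N → signedPartitions≤ K N s ≡ signedPartitions≤ K s s
signedPartitions≤-stable K {s} s≤N = go (ℕ.≤⇒≤′ s≤N)
  where
  go : ∀ {N} → s ≤′ N → signedPartitions≤ K N s ≡ signedPartitions≤ K s s
  go ≤′-refl        = refl
  go (≤′-step s≤′N) = trans (signedPartitions≤-< K _ (s≤s (ℕ.≤′⇒≤ s≤′N))) (go s≤′N)

-- The truncated product and the signed sums

data Offset (d : ℕ) : ℕ → Set where
  below : ∀ {n} → n < d → Offset d n
  above : ∀ n → Offset d (n ℕ.+ d)

offset : ∀ d n → Offset d n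
offset d n with n ℕ.<? d
... | yes n<d = below n<d
... | no  n≮d = subst (Offset d) (ℕ.m∸n+n≡m (ℕ.≮⇒≥ n≮d)) (above (n ∸ d))

-- The bound K on the parts is only needed to make the count finite; it has to stay flexible
-- because removing the first column lowers it by one (signedPartitions-suc).
ratioProd≡signedPartitions≤ : ∀ N s {K} → s ≤ K → ratioProd N s ≡ signedPartitions≤ K N s
ratioProd≡signedPartitions≤ zero    zero    _ = refl
ratioProd≡signedPartitions≤ zero    (suc s) _ = refl
ratioProd≡signedPartitions≤ (suc N) = <-rec Claim step
  where
  open ≡-Reasoning
  Claim : ℕ → Set
  Claim s = ∀ {K} → s ≤ K → ratioProd (suc N) s ≡ signedPartitions≤ K (suc N) s
  step : ∀ s → (∀ {s′} → s′ < s → Claim s′) → Claim s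
  step s rec {K} s≤K with offset (suc N) s
  ... | below s<1+N = begin
    ratioProd (suc N) s              ≡⟨ ratioProd-< N s<1+N ⟩
    ratioProd N s                    ≡⟨ ratioProd≡signedPartitions≤ N s s≤K ⟩
    signedPartitions≤ K N s          ≡⟨ signedPartitions≤-< K N s<1+N ⟨
    signedPartitions≤ K (suc N) s    ∎
  step .(s ℕ.+ suc N) rec {zero}  s+1+N≤0 | above s = ⊥-elim (ℕ.m+1+n≢0 s (ℕ.n≤0⇒n≡0 s+1+N≤0))
  step .(s ℕ.+ suc N) rec {suc K} s+1+N≤1+K | above s = begin
    ratioProd (suc N) (s ℕ.+ suc N)
      ≡⟨ ratioProd-+ N s ⟩
    ratioProd N (s ℕ.+ suc N) + ratioProd N s * + 2 - ratioProd (suc N) s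
      ≡⟨ cong₂ _-_ (cong₂ _+_ (ratioProd≡signedPartitions≤ N (s ℕ.+ suc N) s+1+N≤1+K)
                              (cong (_* + 2) (ratioProd≡signedPartitions≤ N s s≤K)))
                   (rec (ℕ.m<m+n s ℕ.0<1+n) s≤K) ⟩
    signedPartitions≤ (suc K) N (s ℕ.+ suc N) + signedPartitions≤ K N s * + 2 - signedPartitions≤ K (suc N) s
      ≡⟨ signedPartitions≤-+ K N s ⟨
    signedPartitions≤ (suc K) (suc N) (s ℕ.+ suc N)   ∎
    where
    s≤K : s ≤ K
    s≤K = ℕ.≤-trans (ℕ.m≤m+n s N) (ℕ.≤-pred (subst (_≤ suc K) (ℕ.+-suc s N) s+1+N≤1+K))

signedSum≡∑missingSign : ∀ {n N} → n ≤ N → signedSum n N ≡ ∑ (partitions n) missingSign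
signedSum≡∑missingSign {n} {N} n≤N = begin
  ∑[ m ∈ range 0 (suc N) ] (-1ℤ ^ m * + P n m)
    ≡⟨ ∑-cong (range 0 (suc N)) (λ {m} _ → trans (cong (-1ℤ ^ m *_) (count-as-∑ (λ p → missing p ℕ.≟ m) (partitions n)))
                                                 (sym (∑-*ˡ (-1ℤ ^ m) (partitions n) (indicator m)))) ⟩
  ∑[ m ∈ range 0 (suc N) ] ∑[ p ∈ partitions n ] (-1ℤ ^ m * indicator m p)
    ≡⟨ ∑-swap (range 0 (suc N)) (partitions n) (λ m p → -1ℤ ^ m * indicator m p) ⟩
  ∑[ p ∈ partitions n ] ∑[ m ∈ range 0 (suc N) ] (-1ℤ ^ m * indicator m p)
    ≡⟨ ∑-cong (partitions n) (λ {p} p∈ → picks-missing {p} (subst (_≤ N) (sym (∈-partitions⁻ p∈)) n≤N)) ⟩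
  ∑ (partitions n) missingSign   ∎
  where
  open ≡-Reasoning
  indicator : ℕ → List ℕ → ℤ
  indicator m p = keepIf (missing p ≡ᵇ m) 1ℤ
  picks-missing : ∀ {p} → sum p ≤ N → ∑[ m ∈ range 0 (suc N) ] (-1ℤ ^ m * indicator m p) ≡ missingSign p
  picks-missing {p} sum≤N = begin
    ∑[ m ∈ range 0 (suc N) ] (-1ℤ ^ m * indicator m p)
      ≡⟨ ∑-range-single 0 (suc N) _ z≤n (s≤s (ℕ.≤-trans (missing≤sum p) sum≤N))
           (λ {m} _ _ m≢ → trans (cong (λ b → -1ℤ ^ m * keepIf b 1ℤ) (dec-false (missing p ℕ.≟ m) (m≢ ∘ sym)))
                                 (ℤ.*-zeroʳ (-1ℤ ^ m))) ⟩
    missingSign p * indicator (missing p) p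
      ≡⟨ cong (λ b → missingSign p * keepIf b 1ℤ) (dec-true (missing p ℕ.≟ missing p) refl) ⟩
    missingSign p * 1ℤ
      ≡⟨ ℤ.*-identityʳ (missingSign p) ⟩
    missingSign p   ∎

even-odd-difference : (f : A → ℕ) (xs : List A) →
  + length (filter (λ x → T? (isEven (f x))) xs) - + length (filter (λ x → T? (not (isEven (f x)))) xs) ≡
  ∑[ x ∈ xs ] (-1ℤ ^ f x)
even-odd-difference {A} f xs = begin
  + length (filter (λ x → T? (isEven (f x))) xs) - + length (filter (λ x → T? (not (isEven (f x)))) xs)
    ≡⟨ cong₂ _-_ (count-as-∑ (λ x → T? (isEven (f x))) xs) (count-as-∑ (λ x → T? (not (isEven (f x)))) xs) ⟩
  ∑ xs even - ∑ xs odd                   ≡⟨ cong (_+_ (∑ xs even)) (∑-neg xs odd) ⟨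
  ∑ xs even + ∑[ x ∈ xs ] (- odd x)      ≡⟨ ∑-+ xs even (λ x → - odd x) ⟨
  ∑[ x ∈ xs ] (even x - odd x)           ≡⟨ ∑-cong xs (λ {x} _ → -1^-parity (f x)) ⟨
  ∑[ x ∈ xs ] (-1ℤ ^ f x)                ∎
  where
  open ≡-Reasoning
  even odd : A → ℤ
  even x = keepIf (isEven (f x)) 1ℤ
  odd  x = keepIf (not (isEven (f x))) 1ℤ

corollary2p5 : (n : ℕ) →
    ((N : ℕ) → n ≤ N → signedSum n N ≡ (+ Me n) - (+ Mo n)) ×
    ((N : ℕ) → n ≤ N → ratioProd N n ≡ (+ Me n) - (+ Mo n))
corollary2p5 n = (λ N n≤N → trans (signedSum≡∑missingSign n≤N) (sym Me-Mo≡∑missingSign))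
               , (λ N n≤N → begin
                   ratioProd N n                  ≡⟨ ratioProd≡signedPartitions≤ N n ℕ.≤-refl ⟩
                   signedPartitions≤ n N n        ≡⟨ signedPartitions≤-stable n n≤N ⟩
                   signedPartitions≤ n n n        ≡⟨ ∑partitions≡signedPartitions≤ n ⟨
                   ∑ (partitions n) missingSign   ≡⟨ Me-Mo≡∑missingSign ⟨
                   + Me n - + Mo n                ∎)
  where
  open ≡-Reasoning
  Me-Mo≡∑missingSign : + Me n - + Mo n ≡ ∑ (partitions n) missingSign
  Me-Mo≡∑missingSign = even-odd-difference missing (partitions n)
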